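{- Let $C=(c_1,\dots,c_n)\in\mathrm{Mat}_{m\times n}(\mathbb{Z})$ have nonzero columns. For $q\in\mathbb{Z}_{>0}$ and $J\subseteq\{1,\dots,n\}$, let $H_{j,q}=\{x\in\mathbb{Z}_q^m: x[c_j]_q=[0]_q\}$ and $H_{J,q}=\bigcap_{j\in J}H_{j,q}$. For each nonempty $J$, let $C_J$ be the submatrix of $C$ formed by the columns indexed by $J$, and let $e(J)$ be its largest elementary divisor. Put $$\rho_0=\operatorname{lcm}\{e(J):1\le|J|\le\min\{m,n\}\},\qquad q_0=\max_{\emptyset\ne J\subseteq\{1,\dots,n\}}\ \min_{S_J}\ \max\{|u|: u \text{ is an entry of } S_JC \text{ or of } C\},$$ where for each $J$ the minimum is over all unimodular $S_J\in\mathrm{Mat}_{m\times m}(\mathbb{Z})$ for which there is a unimodular $T_J$ with $S_JC_JT_J$ equal to the Smith normal form of $C_J$. Let $J$ be any nonempty subset of $\{1,\dots,n\}$, and let $q,q'\in\mathbb{Z}_{>0}$ satisfy $q,q'>q_0$ and $\gcd\{\rho_0,q\}=\gcd\{\rho_0,q'\}$. Then for every $j\in\{1,\dots,n\}$: $H_{j,q}\supseteq H_{J,q}$ if and only if $H_{j,q'}\supseteq H_{J,q'}$.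
   Context: $\mathbb{Z}_q=\mathbb{Z}/q\mathbb{Z}$; $[c_j]_q$ is the reduction of $c_j$ mod $q$ and $x$ is a row vector. The Smith normal form of an integer matrix $G\in\mathrm{Mat}_{m\times k}(\mathbb{Z})$ of rank $\ell$ is $SGT=\begin{pmatrix}\mathrm{diag}(e_1,\dots,e_\ell)&O\\O&O\end{pmatrix}$ with $S,T$ unimodular and $e_1|\cdots|e_\ell$ positive integers (the elementary divisors); the largest elementary divisor is $e_\ell$. -}

module Defs where

open import Data.Nat as ℕ using (ℕ; zero; suc; _⊔_)
open import Data.Integer as ℤ using (ℤ; +_; ∣_∣)
open import Data.Integer.Divisibility as ℤD using ()
open import Data.Nat.Divisibility as ℕD using ()
open import Data.Fin using (Fin; toℕ; fromℕ) renaming (_<_ to _<ᶠ_)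
open import Data.Vec.Functional using (foldr)
open import Data.Product using (Σ; ∃; _×_)
open import Data.Empty using (⊥)
open import Relation.Nullary using (yes; no)
open import Relation.Binary.PropositionalEquality using (_≡_)

Mat : ℕ → ℕ → Set
Mat m k = Fin m → Fin k → ℤ

Σℤ : ∀ {n} → (Fin n → ℤ) → ℤ
Σℤ = foldr ℤ._+_ (+ 0)

_⊗_ : ∀ {m k l} → Mat m k → Mat k l → Mat m l
(A ⊗ B) i j = Σℤ (λ t → A i t ℤ.* B t j)

Id : ∀ {m} → Mat m m
Id i j with toℕ i ℕ.≟ toℕ j
... | yes _ = + 1
... | no _  = + 0

_≐_ : ∀ {m k} → Mat m k → Mat m k → Set
A ≐ B = ∀ i j → A i j ≡ B i j

Unimodular : ∀ {m} → Mat m m → Set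
Unimodular {m} U = Σ (Mat m m) λ V → (U ⊗ V) ≐ Id × (V ⊗ U) ≐ Id

IsSNF : ∀ {m k} → Mat m k → (ℓ : ℕ) → (Fin ℓ → ℕ) → Set
IsSNF {m} {k} D ℓ e =
  ℓ ℕ.≤ m × ℓ ℕ.≤ k
  × (∀ t → 0 ℕ.< e t)
  × (∀ t u → toℕ u ≡ suc (toℕ t) → e t ℕD.∣ e u)
  × (∀ i j (t : Fin ℓ) → toℕ i ≡ toℕ t → toℕ j ≡ toℕ t → D i j ≡ + e t)
  × (∀ i j → ((t : Fin ℓ) → toℕ i ≡ toℕ t → toℕ j ≡ toℕ t → ⊥) → D i j ≡ + 0)

AdmissibleS : ∀ {m k} → Mat m k → Mat m m → Set
AdmissibleS {m} {k} M S =
  Unimodular S × Σ (Mat k k) λ T → Unimodular T ×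
  Σ ℕ λ ℓ → Σ (Fin ℓ → ℕ) λ e → IsSNF ((S ⊗ M) ⊗ T) ℓ e

IsLargestElemDiv : ∀ {m k} → Mat m k → ℕ → Set
IsLargestElemDiv {m} {k} M d =
  Σ (Mat m m) λ S → Σ (Mat k k) λ T → Unimodular S × Unimodular T ×
  Σ ℕ λ ℓ → Σ (Fin (suc ℓ) → ℕ) λ e →
  IsSNF ((S ⊗ M) ⊗ T) (suc ℓ) e × d ≡ e (fromℕ ℓ)

-- Nonempty subset J of {1,…,n} with |J| = suc k, encoded by its strictly
-- increasing enumeration σ : Fin (suc k) → Fin n.
StrictlyIncreasing : ∀ {k n} → (Fin k → Fin n) → Set
StrictlyIncreasing σ = ∀ a b → a <ᶠ b → σ a <ᶠ σ b

cols : ∀ {m n k} → Mat m n → (Fin k → Fin n) → Mat m k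
cols C σ i a = C i (σ a)

col : ∀ {m n} → Mat m n → Fin n → Fin m → ℤ
col C j i = C i j

maxAbs : ∀ {m k} → Mat m k → ℕ
maxAbs A = foldr _⊔_ 0 (λ i → foldr _⊔_ 0 (λ j → ∣ A i j ∣))

cost : ∀ {m n} → Mat m n → Mat m m → ℕ
cost C S = maxAbs (S ⊗ C) ⊔ maxAbs C

IsMinCost : ∀ {m n k} → Mat m n → (Fin k → Fin n) → ℕ → Set
IsMinCost {m} C σ v =
  (Σ (Mat m m) λ S → AdmissibleS (cols C σ) S × cost C S ≡ v)
  × (∀ S → AdmissibleS (cols C σ) S → v ℕ.≤ cost C S)

IsQ0 : ∀ {m n} → Mat m n → ℕ → Set
IsQ0 {m} {n} C q0 =
  (∀ k (σ : Fin (suc k) → Fin n) → StrictlyIncreasing σ →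
     Σ ℕ λ v → IsMinCost C σ v × v ℕ.≤ q0)
  × (Σ ℕ λ k → Σ (Fin (suc k) → Fin n) λ σ → StrictlyIncreasing σ ×
     IsMinCost C σ q0)

IsSmallE : ∀ {m n} → Mat m n → ℕ → Set
IsSmallE {m} {n} C d =
  Σ ℕ λ k → Σ (Fin (suc k) → Fin n) λ σ → StrictlyIncreasing σ ×
  suc k ℕ.≤ m × suc k ℕ.≤ n × IsLargestElemDiv (cols C σ) d

IsRho0 : ∀ {m n} → Mat m n → ℕ → Set
IsRho0 C ρ0 =
  (∀ d → IsSmallE C d → d ℕD.∣ ρ0)
  × (∀ c → (∀ d → IsSmallE C d → d ℕD.∣ c) → ρ0 ℕD.∣ c)

dot : ∀ {m} → (Fin m → ℤ) → (Fin m → ℤ) → ℤ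
dot x c = Σℤ (λ i → x i ℤ.* c i)

-- x ∈ H_{j,q}, with x ∈ ℤ_q^m represented by integer representatives.
InH : ∀ {m n} → Mat m n → ℕ → Fin n → (Fin m → ℤ) → Set
InH C q j x = (+ q) ℤD.∣ dot x (col C j)

HContains : ∀ {m n k} → Mat m n → ℕ → Fin n → (Fin k → Fin n) → Set
HContains {m} C q j σ =
  ∀ (x : Fin m → ℤ) → (∀ a → InH C q (σ a) x) → InH C q j x

NonzeroColumns : ∀ {m n} → Mat m n → Set
NonzeroColumns C = ∀ j → (∀ i → C i j ≡ + 0) → ⊥

{-# OPTIONS --safe #-}
module Submission where

-- Fix J, and an admissible S of minimal cost with S C_J T = D = diag(d₀, d₁, …),
-- where d_p = 0 beyond the rank. In the coordinates given by S the column lattice of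
-- C_J is {w : d_p ∣ w_p for all p}, so H_{j,q} ⊇ H_{J,q} holds iff gcd(q, d_p) divides
-- the p-th entry s_p of S c_j for every p. When d_p = 0 this says q ∣ s_p, i.e.
-- s_p = 0 because |s_p| ≤ q₀ < q. Otherwise d_p ∣ ρ₀: dropping columns along kernel
-- vectors yields J′ ⊆ J with |J′| ≤ m spanning the same rational space, and d_p divides
-- e(J′) because the column lattice of C_{J′} is saturated up to e(J′). Hence
-- gcd(q, d_p) = gcd(gcd(ρ₀, q), d_p) is the same for q and q′.

open import Defs
open import Data.Nat using (ℕ; suc; _<_)
open import Data.Nat.GCD using (gcd)
open import Data.Fin using (Fin)
open import Data.Product using (_×_)
open import Relation.Binary.PropositionalEquality using (_≡_)
open import Function.Bundles using (_⇔_)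

open import Data.Empty using (⊥; ⊥-elim)
open import Data.Fin as Fin using (toℕ; fromℕ<; punchIn)
import Data.Fin.Properties as Fin
open import Data.Integer as ℤ using (ℤ; +_; ∣_∣; 0ℤ; 1ℤ; _+_; _*_; -_)
import Data.Integer.Divisibility as ℤᵘ
open import Data.Integer.Divisibility.Signed using (_∣_; divides; ∣m∣n⇒∣m+n; ∣m⇒∣m*n; ∣ᵤ⇒∣; ∣⇒∣ᵤ; 0∣⇒≡0)
import Data.Integer.Properties as ℤ
open import Data.Integer.Tactic.RingSolver using (solve-∀)
open import Data.Nat as ℕ using (zero; _≤_; z≤n; _⊔_)
import Data.Nat.Divisibility as ℕ
open import Data.Nat.GCD using (gcd[m,n]∣m; gcd[m,n]∣n; gcd-greatest; gcd-comm; gcd-assoc; gcd-identityʳ; c*gcd[m,n]≡gcd[cm,cn])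
import Data.Nat.Properties as ℕ
open import Algebra.Properties.CommutativeSemigroup ℕ.*-commutativeSemigroup using (x∙yz≈y∙xz)
open import Algebra.Properties.Semiring.Sum ℤ.+-*-semiring
  using (sum; sum-cong-≗; sum-replicate-zero; sum-remove; ∑-comm; *-distribˡ-sum; *-distribʳ-sum; ∑-distrib-+)
open import Data.Product using (Σ; ∃; _,_; proj₁; proj₂)
open import Data.Sum as Sum using (_⊎_; inj₁; inj₂; [_,_]′)
open import Data.Vec.Functional using (Vector; removeAt; insertAt; foldr)
open import Data.Vec.Functional.Properties using (insertAt-lookup; insertAt-punchIn)
open import Function using (_∘_)
open import Function.Bundles using (mk⇔)
open import Function.Definitions using (Injective)
open import Relation.Binary.Definitions using (tri<; tri≈; tri>)
open import Relation.Binary.PropositionalEquality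
  using (_≢_; _≗_; refl; sym; trans; cong; cong₂; subst; subst₂; module ≡-Reasoning)
open import Relation.Nullary using (¬_; yes; no)

sum-zero : ∀ {n} {f : Vector ℤ n} → (∀ i → f i ≡ 0ℤ) → sum f ≡ 0ℤ
sum-zero {n} f≗0 = trans (sum-cong-≗ f≗0) (sum-replicate-zero n)

sum-single : ∀ {n} {f : Vector ℤ n} a → (∀ b → b ≢ a → f b ≡ 0ℤ) → sum f ≡ f a
sum-single {suc n} {f} a others≡0 = begin
  sum f                     ≡⟨ sum-remove f ⟩
  f a + sum (removeAt f a)  ≡⟨ cong (_+_ (f a)) (sum-zero (λ b → others≡0 (punchIn a b) (Fin.punchInᵢ≢i a b))) ⟩
  f a + 0ℤ                  ≡⟨ ℤ.+-identityʳ (f a) ⟩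
  f a                       ∎
  where open ≡-Reasoning

∣-sum : ∀ {n} {k : ℤ} {f : Vector ℤ n} → (∀ i → k ∣ f i) → k ∣ sum f
∣-sum {zero}  {k} _   = divides 0ℤ (sym (ℤ.*-zeroˡ k))
∣-sum {suc n}     k∣f = ∣m∣n⇒∣m+n (k∣f Fin.zero) (∣-sum (k∣f ∘ Fin.suc))

Id-diag : ∀ {m} (i : Fin m) → Id i i ≡ 1ℤ
Id-diag i with toℕ i ℕ.≟ toℕ i
... | yes _  = refl
... | no i≢i = ⊥-elim (i≢i refl)

Id-off : ∀ {m} {i j : Fin m} → i ≢ j → Id i j ≡ 0ℤ
Id-off {i = i} {j} i≢j with toℕ i ℕ.≟ toℕ j
... | yes i≡j = ⊥-elim (i≢j (Fin.toℕ-injective i≡j))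
... | no _    = refl

infixr 7 _*ᵥ_ _·_
infixl 7 _ᵥ*_

_*ᵥ_ : ∀ {m k} → Mat m k → Vector ℤ k → Vector ℤ m
(M *ᵥ z) i = dot (M i) z

_ᵥ*_ : ∀ {m k} → Vector ℤ m → Mat m k → Vector ℤ k
(x ᵥ* M) j = dot x (col M j)

_·_ : ℤ → ∀ {m} → Vector ℤ m → Vector ℤ m
(a · v) i = a * v i

dot-congʳ : ∀ {m} (x : Vector ℤ m) {z w} → z ≗ w → dot x z ≡ dot x w
dot-congʳ x z≗w = sum-cong-≗ (λ i → cong (x i *_) (z≗w i))

dot-unitʳ : ∀ {m} (x : Vector ℤ m) a → dot x (col Id a) ≡ x a
dot-unitʳ x a = trans (sum-single a (λ b b≢a → trans (cong (x b *_) (Id-off b≢a)) (ℤ.*-zeroʳ (x b))))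
                      (trans (cong (x a *_) (Id-diag a)) (ℤ.*-identityʳ (x a)))

dot-scaleˡ : ∀ {m} a (x z : Vector ℤ m) → dot (a · x) z ≡ a * dot x z
dot-scaleˡ a x z = trans (sum-cong-≗ (λ i → ℤ.*-assoc a (x i) (z i))) (sym (*-distribˡ-sum a (λ i → x i * z i)))

dot-scaleʳ : ∀ {m} a (x z : Vector ℤ m) → dot x (a · z) ≡ a * dot x z
dot-scaleʳ a x z = trans (sum-cong-≗ (λ i → swap (x i) a (z i))) (sym (*-distribˡ-sum a (λ i → x i * z i)))
  where
  swap : ∀ b c d → b * (c * d) ≡ c * (b * d)
  swap = solve-∀

dot-lincombʳ : ∀ {m} (x z w : Vector ℤ m) a b → dot x (λ i → a * z i + b * w i) ≡ a * dot x z + b * dot x w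
dot-lincombʳ x z w a b = begin
  dot x (λ i → a * z i + b * w i)            ≡⟨ sum-cong-≗ (λ i → ℤ.*-distribˡ-+ (x i) (a * z i) (b * w i)) ⟩
  sum (λ i → x i * (a * z i) + x i * (b * w i)) ≡⟨ ∑-distrib-+ (λ i → x i * (a * z i)) (λ i → x i * (b * w i)) ⟩
  dot x (a · z) + dot x (b · w)              ≡⟨ cong₂ _+_ (dot-scaleʳ a x z) (dot-scaleʳ b x w) ⟩
  a * dot x z + b * dot x w                  ∎
  where open ≡-Reasoning

dot-*ᵥ : ∀ {m k} (x : Vector ℤ m) (M : Mat m k) z → dot x (M *ᵥ z) ≡ dot (x ᵥ* M) z
dot-*ᵥ x M z = begin
  sum (λ i → x i * sum (λ t → M i t * z t))    ≡⟨ sum-cong-≗ (λ i → *-distribˡ-sum (x i) (λ t → M i t * z t)) ⟩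
  sum (λ i → sum (λ t → x i * (M i t * z t)))  ≡⟨ ∑-comm (λ i t → x i * (M i t * z t)) ⟩
  sum (λ t → sum (λ i → x i * (M i t * z t)))  ≡⟨ sum-cong-≗ (λ t → sum-cong-≗ (λ i → sym (ℤ.*-assoc (x i) (M i t) (z t)))) ⟩
  sum (λ t → sum (λ i → x i * M i t * z t))    ≡⟨ sum-cong-≗ (λ t → sym (*-distribʳ-sum (z t) (λ i → x i * M i t))) ⟩
  sum (λ t → sum (λ i → x i * M i t) * z t)    ∎
  where open ≡-Reasoning

*ᵥ-⊗ : ∀ {m k l} (A : Mat m k) (B : Mat k l) z → (A ⊗ B) *ᵥ z ≗ A *ᵥ B *ᵥ z
*ᵥ-⊗ A B z i = sym (dot-*ᵥ (A i) B z)

*ᵥ-congˡ : ∀ {m k} {A B : Mat m k} → A ≐ B → ∀ z → A *ᵥ z ≗ B *ᵥ z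
*ᵥ-congˡ A≐B z i = sum-cong-≗ (λ t → cong (_* z t) (A≐B i t))

*ᵥ-congʳ : ∀ {m k} (M : Mat m k) {z w} → z ≗ w → M *ᵥ z ≗ M *ᵥ w
*ᵥ-congʳ M z≗w i = dot-congʳ (M i) z≗w

*ᵥ-zero : ∀ {m k} (M : Mat m k) → M *ᵥ (λ _ → 0ℤ) ≗ (λ _ → 0ℤ)
*ᵥ-zero M i = sum-zero (λ t → ℤ.*-zeroʳ (M i t))

Id-*ᵥ : ∀ {m} (z : Vector ℤ m) → Id *ᵥ z ≗ z
Id-*ᵥ z i = trans (sum-single i (λ b b≢i → trans (cong (_* z b) (Id-off (b≢i ∘ sym))) (ℤ.*-zeroˡ (z b))))
                  (trans (cong (_* z i) (Id-diag i)) (ℤ.*-identityˡ (z i)))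

*ᵥ-inverse : ∀ {m} (U V : Mat m m) → (U ⊗ V) ≐ Id → ∀ z → U *ᵥ V *ᵥ z ≗ z
*ᵥ-inverse U V U⊗V≐Id z i = begin
  (U *ᵥ V *ᵥ z) i  ≡⟨ *ᵥ-⊗ U V z i ⟨
  ((U ⊗ V) *ᵥ z) i ≡⟨ *ᵥ-congˡ U⊗V≐Id z i ⟩
  (Id *ᵥ z) i      ≡⟨ Id-*ᵥ z i ⟩
  z i              ∎
  where open ≡-Reasoning

infix 4 _∈L_ _⊆ᴸ_ _⊆ℚᴸ_

_∈L_ : ∀ {m k} → Vector ℤ m → Mat m k → Set
v ∈L M = ∃ λ z → v ≗ M *ᵥ z

_⊆ᴸ_ : ∀ {m k k′} → Mat m k → Mat m k′ → Set
M ⊆ᴸ M′ = ∀ {v} → v ∈L M → v ∈L M′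

_⊆ℚᴸ_ : ∀ {m k k′} → Mat m k → Mat m k′ → Set
M ⊆ℚᴸ M′ = ∀ {v} → v ∈L M → ∃ λ N → N ≢ 0ℤ × N · v ∈L M′

∈L-resp-≗ : ∀ {m k} (M : Mat m k) {v w} → v ≗ w → v ∈L M → w ∈L M
∈L-resp-≗ M v≗w (z , v≗Mz) = z , λ i → trans (sym (v≗w i)) (v≗Mz i)

col∈L : ∀ {m k} (M : Mat m k) a → col M a ∈L M
col∈L M a = col Id a , λ i → sym (dot-unitʳ (M i) a)

∣-dot-∈L : ∀ {m k} {c : ℤ} (x : Vector ℤ m) (M : Mat m k) {v} →
           (∀ a → c ∣ dot x (col M a)) → v ∈L M → c ∣ dot x v
∣-dot-∈L {c = c} x M c∣xM (z , v≗Mz) =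
  subst (c ∣_) (sym (trans (dot-congʳ x v≗Mz) (dot-*ᵥ x M z))) (∣-sum (λ a → ∣m⇒∣m*n (z a) (c∣xM a)))

-- HContains C q j σ unfolds to Entails q (cols C σ) (col C j).
Entails : ∀ {m k} → ℕ → Mat m k → Vector ℤ m → Set
Entails q M c = ∀ x → (∀ a → + q ℤᵘ.∣ dot x (col M a)) → + q ℤᵘ.∣ dot x c

*-≢0 : ∀ {a b} → a ≢ 0ℤ → b ≢ 0ℤ → a * b ≢ 0ℤ
*-≢0 {a} a≢0 b≢0 ab≡0 = [ a≢0 , b≢0 ]′ (ℤ.i*j≡0⇒i≡0∨j≡0 a ab≡0)

⊆ℚᴸ-refl : ∀ {m k} (M : Mat m k) → M ⊆ℚᴸ M
⊆ℚᴸ-refl M v∈L = 1ℤ , (λ ()) , ∈L-resp-≗ M (λ i → sym (ℤ.*-identityˡ _)) v∈L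

⊆ℚᴸ-trans : ∀ {m k₁ k₂ k₃} (M₁ : Mat m k₁) (M₂ : Mat m k₂) (M₃ : Mat m k₃) →
            M₁ ⊆ℚᴸ M₂ → M₂ ⊆ℚᴸ M₃ → M₁ ⊆ℚᴸ M₃
⊆ℚᴸ-trans M₁ M₂ M₃ M₁⊆M₂ M₂⊆M₃ v∈L =
  let (N₁ , N₁≢0 , N₁v∈L)    = M₁⊆M₂ v∈L
      (N₂ , N₂≢0 , N₂N₁v∈L) = M₂⊆M₃ N₁v∈L
  in  N₂ * N₁ , *-≢0 N₂≢0 N₁≢0 , ∈L-resp-≗ M₃ (λ i → sym (ℤ.*-assoc N₂ N₁ _)) N₂N₁v∈L

removeCol : ∀ {m k} → Mat m (suc k) → Fin (suc k) → Mat m k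
removeCol M a i = removeAt (M i) a

*ᵥ-removeCol : ∀ {m k} (M : Mat m (suc k)) {a z} → z a ≡ 0ℤ → M *ᵥ z ≗ removeCol M a *ᵥ removeAt z a
*ᵥ-removeCol M {a} {z} za≡0 i = begin
  (M *ᵥ z) i                                       ≡⟨ sum-remove {i = a} (λ t → M i t * z t) ⟩
  M i a * z a + (removeCol M a *ᵥ removeAt z a) i  ≡⟨ cong (λ c → M i a * c + (removeCol M a *ᵥ removeAt z a) i) za≡0 ⟩
  M i a * 0ℤ + (removeCol M a *ᵥ removeAt z a) i   ≡⟨ cong (_+ (removeCol M a *ᵥ removeAt z a) i) (ℤ.*-zeroʳ (M i a)) ⟩
  0ℤ + (removeCol M a *ᵥ removeAt z a) i           ≡⟨ ℤ.+-identityˡ _ ⟩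
  (removeCol M a *ᵥ removeAt z a) i                ∎
  where open ≡-Reasoning

removeCol-⊆ᴸ : ∀ {m k} (M : Mat m (suc k)) a → removeCol M a ⊆ᴸ M
removeCol-⊆ᴸ M a {v} (z , v≗M′z) = z′ , λ i → begin
  v i                                 ≡⟨ v≗M′z i ⟩
  (removeCol M a *ᵥ z) i              ≡⟨ *ᵥ-congʳ (removeCol M a) (insertAt-punchIn z a 0ℤ) i ⟨
  (removeCol M a *ᵥ removeAt z′ a) i  ≡⟨ *ᵥ-removeCol M {a} {z′} (insertAt-lookup z a 0ℤ) i ⟨
  (M *ᵥ z′) i                         ∎
  where
  open ≡-Reasoning
  z′ = insertAt z a 0ℤ

-- w a · M z = M (w a · z − z a · w), and that coefficient vector vanishes at a.
kernel⇒⊆ℚᴸ-removeCol : ∀ {m k} (M : Mat m (suc k)) {w a} → M *ᵥ w ≗ (λ _ → 0ℤ) → w a ≢ 0ℤ →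
                       M ⊆ℚᴸ removeCol M a
kernel⇒⊆ℚᴸ-removeCol M {w} {a} Mw≗0 wa≢0 {v} (z , v≗Mz) = w a , wa≢0 , removeAt z′ a , λ i → begin
  w a * v i                               ≡⟨ cong (w a *_) (v≗Mz i) ⟩
  w a * (M *ᵥ z) i                        ≡⟨ ℤ.+-identityʳ _ ⟨
  w a * (M *ᵥ z) i + 0ℤ                   ≡⟨ cong (_+_ (w a * (M *ᵥ z) i)) (trans (cong (- z a *_) (Mw≗0 i)) (ℤ.*-zeroʳ (- z a))) ⟨
  w a * (M *ᵥ z) i + - z a * (M *ᵥ w) i   ≡⟨ dot-lincombʳ (M i) z w (w a) (- z a) ⟨
  (M *ᵥ z′) i                             ≡⟨ *ᵥ-removeCol M {a} {z′} (cancel (w a) (z a)) i ⟩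
  (removeCol M a *ᵥ removeAt z′ a) i      ∎
  where
  open ≡-Reasoning
  z′ : Vector ℤ (suc _)
  z′ t = w a * z t + - z a * w t
  cancel : ∀ x y → x * y + - y * x ≡ 0ℤ
  cancel = solve-∀

gcd∣⇒∣* : ∀ {q e s} h → gcd q e ℕ.∣ s → q ℕ.∣ h ℕ.* e → q ℕ.∣ h ℕ.* s
gcd∣⇒∣* {q} {e} h g∣s q∣he = ℕ.∣-trans
  (subst (q ℕ.∣_) (sym (c*gcd[m,n]≡gcd[cm,cn] h q e)) (gcd-greatest (ℕ.n∣m*n h) q∣he))
  (ℕ.*-monoʳ-∣ h g∣s)

-- Take h = q / gcd q e: then q ∣ h e, and q ∣ h s cancels to gcd q e ∣ s.
∣*⇒gcd∣ : ∀ {q e s} → 0 < q → (∀ h → q ℕ.∣ h ℕ.* e → q ℕ.∣ h ℕ.* s) → gcd q e ℕ.∣ s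
∣*⇒gcd∣ {q} {e} {s} 0<q q∣h* = ℕ.*-cancelˡ-∣ h {{ℕ.≢-nonZero h≢0}} (subst (ℕ._∣ h ℕ.* s) q≡hg (q∣h* h q∣he))
  where
  open ≡-Reasoning
  g = gcd q e
  h = ℕ.quotient (gcd[m,n]∣m q e)
  e′ = ℕ.quotient (gcd[m,n]∣n q e)
  q≡hg : q ≡ h ℕ.* g
  q≡hg = ℕ.m∣n⇒n≡quotient*m (gcd[m,n]∣m q e)
  h≢0 : h ≢ 0
  h≢0 h≡0 = ℕ.<⇒≢ 0<q (sym (trans q≡hg (cong (ℕ._* g) h≡0)))
  q∣he : q ℕ.∣ h ℕ.* e
  q∣he = ℕ.divides e′ (begin
    h ℕ.* e          ≡⟨ cong (h ℕ.*_) (ℕ.m∣n⇒n≡quotient*m (gcd[m,n]∣n q e)) ⟩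
    h ℕ.* (e′ ℕ.* g) ≡⟨ x∙yz≈y∙xz h e′ g ⟩
    e′ ℕ.* (h ℕ.* g) ≡⟨ cong (e′ ℕ.*_) q≡hg ⟨
    e′ ℕ.* q         ∎)

gcd-cong-∣ : ∀ {e ρ q q′} → e ℕ.∣ ρ → gcd ρ q ≡ gcd ρ q′ → gcd q e ≡ gcd q′ e
gcd-cong-∣ {e} {ρ} {q} {q′} e∣ρ gcd≡ = begin
  gcd q e            ≡⟨ cong (gcd q) gcd[ρ,e]≡e ⟨
  gcd q (gcd ρ e)    ≡⟨ gcd-assoc q ρ e ⟨
  gcd (gcd q ρ) e    ≡⟨ cong (λ g → gcd g e) (trans (gcd-comm q ρ) (trans gcd≡ (gcd-comm ρ q′))) ⟩
  gcd (gcd q′ ρ) e   ≡⟨ gcd-assoc q′ ρ e ⟩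
  gcd q′ (gcd ρ e)   ≡⟨ cong (gcd q′) gcd[ρ,e]≡e ⟩
  gcd q′ e           ∎
  where
  open ≡-Reasoning
  gcd[ρ,e]≡e : gcd ρ e ≡ e
  gcd[ρ,e]≡e = ℕ.∣-antisym (gcd[m,n]∣n ρ e) (gcd-greatest e∣ρ ℕ.∣-refl)

∣∧<⇒≡0 : ∀ {q s} → q ℕ.∣ s → s < q → s ≡ 0
∣∧<⇒≡0 {s = zero}  _   _   = refl
∣∧<⇒≡0 {s = suc s} q∣s s<q = ⊥-elim (ℕ.<⇒≱ s<q (ℕ.∣⇒≤ q∣s))

-- For e = 0 the hypothesis reads q ∣ s, which forces s = 0 as s < q.
gcd∣-transfer : ∀ {ρ q q′ e s} → e ℕ.∣ ρ ⊎ e ≡ 0 → gcd ρ q ≡ gcd ρ q′ → s < q →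
                gcd q e ℕ.∣ s → gcd q′ e ℕ.∣ s
gcd∣-transfer (inj₁ e∣ρ) gcd≡ _ g∣s = subst (ℕ._∣ _) (gcd-cong-∣ e∣ρ gcd≡) g∣s
gcd∣-transfer {q = q} {q′} (inj₂ refl) _ s<q g∣s =
  subst (gcd q′ 0 ℕ.∣_) (sym (∣∧<⇒≡0 (subst (ℕ._∣ _) (gcd-identityʳ q) g∣s) s<q)) (gcd q′ 0 ℕ.∣0)

pad : ∀ {ℓ} → (Fin ℓ → ℕ) → ℕ → ℕ
pad {ℓ} e i with i ℕ.<? ℓ
... | yes i<ℓ = e (fromℕ< i<ℓ)
... | no _    = 0

pad-< : ∀ {ℓ} (e : Fin ℓ → ℕ) {i} (i<ℓ : i < ℓ) → pad e i ≡ e (fromℕ< i<ℓ)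
pad-< {ℓ} e {i} i<ℓ with i ℕ.<? ℓ
... | yes _  = refl
... | no i≮ℓ = ⊥-elim (i≮ℓ i<ℓ)

pad-≥ : ∀ {ℓ} (e : Fin ℓ → ℕ) {i} → ℓ ≤ i → pad e i ≡ 0
pad-≥ {ℓ} e {i} ℓ≤i with i ℕ.<? ℓ
... | yes i<ℓ = ⊥-elim (ℕ.<⇒≱ i<ℓ ℓ≤i)
... | no _    = refl

reindex : ∀ {m k} → Vector ℤ m → Vector ℤ k
reindex {m} y b with toℕ b ℕ.<? m
... | yes b<m = y (fromℕ< b<m)
... | no _    = 0ℤ

reindex-toℕ : ∀ {m k} (y : Vector ℤ m) {b : Fin k} {p : Fin m} → toℕ b ≡ toℕ p → reindex y b ≡ y p
reindex-toℕ {m} y {b} {p} b≡p with toℕ b ℕ.<? m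
... | yes b<m = cong y (Fin.toℕ-injective (trans (Fin.toℕ-fromℕ< b<m) b≡p))
... | no b≮m  = ⊥-elim (b≮m (subst (_< m) (sym b≡p) (Fin.toℕ<n p)))

record Diagonal {m k} (D : Mat m k) (d : ℕ → ℕ) : Set where
  field
    on  : ∀ i j → toℕ i ≡ toℕ j → D i j ≡ + d (toℕ i)
    off : ∀ i j → toℕ i ≢ toℕ j → D i j ≡ 0ℤ

  off-*ᵥ : ∀ {p b w} → toℕ p ≢ toℕ b → D p b * w ≡ 0ℤ
  off-*ᵥ {p} {b} {w} p≢b = trans (cong (_* w) (off p b p≢b)) (ℤ.*-zeroˡ w)

  d∣*ᵥ : ∀ w p → + d (toℕ p) ∣ (D *ᵥ w) p
  d∣*ᵥ w p = ∣-sum term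
    where
    term : ∀ b → + d (toℕ p) ∣ D p b * w b
    term b with toℕ p ℕ.≟ toℕ b
    ... | yes p≡b = subst (λ c → + d (toℕ p) ∣ c * w b) (sym (on p b p≡b))
                          (∣m⇒∣m*n (w b) (divides 1ℤ (sym (ℤ.*-identityˡ _))))
    ... | no p≢b  = subst (+ d (toℕ p) ∣_) (sym (off-*ᵥ p≢b)) (divides 0ℤ (sym (ℤ.*-zeroˡ (+ d (toℕ p)))))

  -- Rows p ≥ k of D vanish, hence the hypothesis on d.
  *ᵥ-reindex : (∀ i → k ≤ i → d i ≡ 0) → ∀ y p → (D *ᵥ reindex y) p ≡ + d (toℕ p) * y p
  *ᵥ-reindex d≡0 y p with ℕ.<-≤-connex (toℕ p) k
  ... | inj₁ p<k = trans (sum-single b (λ c c≢b → off-*ᵥ (λ p≡c → c≢b (Fin.toℕ-injective (trans (sym p≡c) p≡b)))))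
                         (cong₂ _*_ (on p b p≡b) (reindex-toℕ y (sym p≡b)))
    where
    b = fromℕ< p<k
    p≡b = sym (Fin.toℕ-fromℕ< p<k)
  ... | inj₂ k≤p = trans (sum-zero (λ c → off-*ᵥ (λ p≡c → ℕ.<⇒≱ (subst (_< k) (sym p≡c) (Fin.toℕ<n c)) k≤p)))
                         (cong (λ c → + c * y p) (sym (d≡0 (toℕ p) k≤p)))

record SmithForm {m k} (M : Mat m k) : Set where
  constructor mkSmithForm
  field
    S S⁻¹ : Mat m m
    T T⁻¹ : Mat k k
    S⊗S⁻¹ : (S ⊗ S⁻¹) ≐ Id
    S⁻¹⊗S : (S⁻¹ ⊗ S) ≐ Id
    T⊗T⁻¹ : (T ⊗ T⁻¹) ≐ Id
    T⁻¹⊗T : (T⁻¹ ⊗ T) ≐ Id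
    rank  : ℕ
    e     : Fin rank → ℕ
    isSNF : IsSNF ((S ⊗ M) ⊗ T) rank e

  D : Mat m k
  D = (S ⊗ M) ⊗ T

  d : ℕ → ℕ
  d = pad e

  rank≤k : rank ≤ k
  rank≤k = proj₁ (proj₂ isSNF)

  private
    e-pos : ∀ t → 0 < e t
    e-pos = proj₁ (proj₂ (proj₂ isSNF))

    e-∣-next : ∀ t u → toℕ u ≡ suc (toℕ t) → e t ℕ.∣ e u
    e-∣-next = proj₁ (proj₂ (proj₂ (proj₂ isSNF)))

    D-diag : ∀ i j (t : Fin rank) → toℕ i ≡ toℕ t → toℕ j ≡ toℕ t → D i j ≡ + e t
    D-diag = proj₁ (proj₂ (proj₂ (proj₂ (proj₂ isSNF))))

    D-rest : ∀ i j → (∀ (t : Fin rank) → toℕ i ≡ toℕ t → toℕ j ≡ toℕ t → ⊥) → D i j ≡ 0ℤ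
    D-rest = proj₂ (proj₂ (proj₂ (proj₂ (proj₂ isSNF))))

  d-≥ : ∀ {i} → rank ≤ i → d i ≡ 0
  d-≥ = pad-≥ e

  d-pos : ∀ {i} → i < rank → 0 < d i
  d-pos i<rank = subst (0 <_) (sym (pad-< e i<rank)) (e-pos _)

  d-∣ : ∀ {i j} → i ≤ j → j < rank → d i ℕ.∣ d j
  d-∣ {i} {zero}  z≤n _ = ℕ.∣-refl
  d-∣ {i} {suc j} i≤1+j 1+j<rank with ℕ.m≤n⇒m<n∨m≡n i≤1+j
  ... | inj₂ refl   = ℕ.∣-refl
  ... | inj₁ i<1+j  = ℕ.∣-trans (d-∣ (ℕ.s≤s⁻¹ i<1+j) j<rank) dⱼ∣d₁₊ⱼ
    where
    j<rank = ℕ.<-trans (ℕ.n<1+n j) 1+j<rank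
    dⱼ∣d₁₊ⱼ : d j ℕ.∣ d (suc j)
    dⱼ∣d₁₊ⱼ = subst₂ ℕ._∣_ (sym (pad-< e j<rank)) (sym (pad-< e 1+j<rank))
                (e-∣-next _ _ (trans (Fin.toℕ-fromℕ< 1+j<rank) (cong suc (sym (Fin.toℕ-fromℕ< j<rank)))))

  diagonal : Diagonal D d
  diagonal = record { on = on ; off = off }
    where
    on : ∀ i j → toℕ i ≡ toℕ j → D i j ≡ + d (toℕ i)
    on i j i≡j with ℕ.<-≤-connex (toℕ i) rank
    ... | inj₁ i<rank = trans (D-diag i j (fromℕ< i<rank) i≡t (trans (sym i≡j) i≡t)) (cong +_ (sym (pad-< e i<rank)))
      where i≡t = sym (Fin.toℕ-fromℕ< i<rank)
    ... | inj₂ rank≤i = trans (D-rest i j (λ t i≡t _ → ℕ.<⇒≱ (subst (_< rank) (sym i≡t) (Fin.toℕ<n t)) rank≤i))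
                              (cong +_ (sym (d-≥ rank≤i)))
    off : ∀ i j → toℕ i ≢ toℕ j → D i j ≡ 0ℤ
    off i j i≢j = D-rest i j (λ t i≡t j≡t → i≢j (trans i≡t (sym j≡t)))

  open Diagonal diagonal using (d∣*ᵥ; *ᵥ-reindex)

  S⁻¹*ᵥS : ∀ v → S⁻¹ *ᵥ S *ᵥ v ≗ v
  S⁻¹*ᵥS = *ᵥ-inverse S⁻¹ S S⁻¹⊗S

  T*ᵥT⁻¹ : ∀ z → T *ᵥ T⁻¹ *ᵥ z ≗ z
  T*ᵥT⁻¹ = *ᵥ-inverse T T⁻¹ T⊗T⁻¹

  T⁻¹*ᵥT : ∀ z → T⁻¹ *ᵥ T *ᵥ z ≗ z
  T⁻¹*ᵥT = *ᵥ-inverse T⁻¹ T T⁻¹⊗T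

  S*ᵥM*ᵥT : ∀ w → S *ᵥ M *ᵥ T *ᵥ w ≗ D *ᵥ w
  S*ᵥM*ᵥT w i = begin
    (S *ᵥ M *ᵥ T *ᵥ w) i   ≡⟨ *ᵥ-⊗ S M (T *ᵥ w) i ⟨
    ((S ⊗ M) *ᵥ T *ᵥ w) i  ≡⟨ *ᵥ-⊗ (S ⊗ M) T w i ⟨
    (D *ᵥ w) i             ∎
    where open ≡-Reasoning

  M*ᵥT : ∀ w → M *ᵥ T *ᵥ w ≗ S⁻¹ *ᵥ D *ᵥ w
  M*ᵥT w i = trans (sym (S⁻¹*ᵥS (M *ᵥ T *ᵥ w) i)) (*ᵥ-congʳ S⁻¹ (S*ᵥM*ᵥT w) i)

  S*ᵥM : ∀ z → S *ᵥ M *ᵥ z ≗ D *ᵥ T⁻¹ *ᵥ z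
  S*ᵥM z i = trans (*ᵥ-congʳ S (*ᵥ-congʳ M (λ t → sym (T*ᵥT⁻¹ z t))) i) (S*ᵥM*ᵥT (T⁻¹ *ᵥ z) i)

  S*ᵥ·colS⁻¹ : ∀ a p r → (S *ᵥ a · col S⁻¹ p) r ≡ a * Id r p
  S*ᵥ·colS⁻¹ a p r = trans (dot-scaleʳ a (S r) (col S⁻¹ p)) (cong (a *_) (S⊗S⁻¹ r p))

  S*ᵥ·colS⁻¹-diag : ∀ a p → (S *ᵥ a · col S⁻¹ p) p ≡ a
  S*ᵥ·colS⁻¹-diag a p = trans (S*ᵥ·colS⁻¹ a p p) (trans (cong (a *_) (Id-diag p)) (ℤ.*-identityʳ a))

  ∈L⇒d∣ : ∀ {v} → v ∈L M → ∀ p → + d (toℕ p) ∣ (S *ᵥ v) p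
  ∈L⇒d∣ (z , v≗Mz) p = subst (+ d (toℕ p) ∣_) (sym (trans (*ᵥ-congʳ S v≗Mz p) (S*ᵥM z p))) (d∣*ᵥ (T⁻¹ *ᵥ z) p)

  d∣⇒∈L : ∀ {v} → (∀ p → + d (toℕ p) ∣ (S *ᵥ v) p) → v ∈L M
  d∣⇒∈L {v} d∣Sv = T *ᵥ w , λ i → begin
    v i                ≡⟨ S⁻¹*ᵥS v i ⟨
    (S⁻¹ *ᵥ S *ᵥ v) i  ≡⟨ *ᵥ-congʳ S⁻¹ Sv≗Dw i ⟩
    (S⁻¹ *ᵥ D *ᵥ w) i  ≡⟨ M*ᵥT w i ⟨
    (M *ᵥ T *ᵥ w) i    ∎
    where
    open ≡-Reasoning
    y : Vector ℤ m
    y p = _∣_.quotient (d∣Sv p)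
    w = reindex y
    Sv≗Dw : S *ᵥ v ≗ D *ᵥ w
    Sv≗Dw p = trans (_∣_.equality (d∣Sv p))
                    (trans (ℤ.*-comm (y p) _) (sym (*ᵥ-reindex (λ i k≤i → d-≥ (ℕ.≤-trans rank≤k k≤i)) y p)))

  d·colS⁻¹∈L : ∀ p → + d (toℕ p) · col S⁻¹ p ∈L M
  d·colS⁻¹∈L p = d∣⇒∈L (λ r → subst (+ d (toℕ r) ∣_) (sym (S*ᵥ·colS⁻¹ (+ d (toℕ p)) p r)) (d∣ r))
    where
    d∣ : ∀ r → + d (toℕ r) ∣ + d (toℕ p) * Id r p
    d∣ r with r Fin.≟ p
    ... | yes refl = ∣m⇒∣m*n (Id r r) (divides 1ℤ (sym (ℤ.*-identityˡ _)))
    ... | no r≢p   = subst (+ d (toℕ r) ∣_) (sym (trans (cong (+ d (toℕ p) *_) (Id-off r≢p)) (ℤ.*-zeroʳ (+ d (toℕ p)))))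
                           (divides 0ℤ (sym (ℤ.*-zeroˡ (+ d (toℕ r)))))

  ∈L⇒S*ᵥ≡0 : ∀ {v} → v ∈L M → ∀ {p} → rank ≤ toℕ p → (S *ᵥ v) p ≡ 0ℤ
  ∈L⇒S*ᵥ≡0 {v} v∈L {p} rank≤p = 0∣⇒≡0 (subst (λ c → + c ∣ (S *ᵥ v) p) (d-≥ rank≤p) (∈L⇒d∣ v∈L p))

  rank≡0⇒∈L-trivial : rank ≡ 0 → ∀ {v} → v ∈L M → v ≗ (λ _ → 0ℤ)
  rank≡0⇒∈L-trivial rank≡0 {v} v∈L i = begin
    v i                    ≡⟨ S⁻¹*ᵥS v i ⟨
    (S⁻¹ *ᵥ S *ᵥ v) i      ≡⟨ *ᵥ-congʳ S⁻¹ (λ p → ∈L⇒S*ᵥ≡0 v∈L (subst (_≤ toℕ p) (sym rank≡0) z≤n)) i ⟩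
    (S⁻¹ *ᵥ (λ _ → 0ℤ)) i  ≡⟨ *ᵥ-zero S⁻¹ i ⟩
    0ℤ                     ∎
    where open ≡-Reasoning

  saturate : ∀ {l} → rank ≡ suc l → ∀ {N v} → N ≢ 0ℤ → N · v ∈L M → + d l · v ∈L M
  saturate {l} rank≡ {N} {v} N≢0 Nv∈L =
    d∣⇒∈L (λ p → subst (+ d (toℕ p) ∣_) (sym (dot-scaleʳ (+ d l) (S p) v)) (d∣ p))
    where
    l<rank : l < rank
    l<rank = subst (l <_) (sym rank≡) (ℕ.n<1+n l)
    Sv≡0 : ∀ {p} → rank ≤ toℕ p → (S *ᵥ v) p ≡ 0ℤ
    Sv≡0 {p} rank≤p = [ (λ N≡0 → ⊥-elim (N≢0 N≡0)) , (λ Sv≡0 → Sv≡0) ]′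
      (ℤ.i*j≡0⇒i≡0∨j≡0 N (trans (sym (dot-scaleʳ N (S p) v)) (∈L⇒S*ᵥ≡0 Nv∈L rank≤p)))
    d∣ : ∀ p → + d (toℕ p) ∣ + d l * (S *ᵥ v) p
    d∣ p with ℕ.<-≤-connex (toℕ p) rank
    ... | inj₁ p<rank = ∣m⇒∣m*n ((S *ᵥ v) p)
                            (∣ᵤ⇒∣ {+ d (toℕ p)} {+ d l} (d-∣ (ℕ.s≤s⁻¹ (subst (toℕ p <_) rank≡ p<rank)) l<rank))
    ... | inj₂ rank≤p = subst (λ c → + c ∣ + d l * (S *ᵥ v) p) (sym (d-≥ rank≤p))
                              (subst (λ c → 0ℤ ∣ + d l * c) (sym (Sv≡0 rank≤p)) (divides 0ℤ (ℤ.*-zeroʳ (+ d l))))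

  wide⇒kernel : m < k → ∃ λ w → ∃ λ a → w a ≢ 0ℤ × M *ᵥ w ≗ (λ _ → 0ℤ)
  wide⇒kernel m<k = w , proj₁ nonzero , proj₂ nonzero , Mw≗0
    where
    open ≡-Reasoning
    b = fromℕ< m<k
    w = T *ᵥ col Id b
    Db≗0 : D *ᵥ col Id b ≗ (λ _ → 0ℤ)
    Db≗0 i = trans (dot-unitʳ (D i) b)
                   (Diagonal.off diagonal i b (λ i≡b → ℕ.<⇒≢ (Fin.toℕ<n i) (trans i≡b (Fin.toℕ-fromℕ< m<k))))
    Mw≗0 : M *ᵥ w ≗ (λ _ → 0ℤ)
    Mw≗0 i = begin
      (M *ᵥ T *ᵥ col Id b) i    ≡⟨ M*ᵥT (col Id b) i ⟩
      (S⁻¹ *ᵥ D *ᵥ col Id b) i  ≡⟨ *ᵥ-congʳ S⁻¹ Db≗0 i ⟩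
      (S⁻¹ *ᵥ (λ _ → 0ℤ)) i     ≡⟨ *ᵥ-zero S⁻¹ i ⟩
      0ℤ                        ∎
    1≢0 : 1ℤ ≢ 0ℤ
    1≢0 ()
    w≢0 : ¬ (∀ a → w a ≡ 0ℤ)
    w≢0 w≗0 = 1≢0 (begin
      1ℤ                     ≡⟨ Id-diag b ⟨
      col Id b b             ≡⟨ T⁻¹*ᵥT (col Id b) b ⟨
      (T⁻¹ *ᵥ w) b           ≡⟨ *ᵥ-congʳ T⁻¹ w≗0 b ⟩
      (T⁻¹ *ᵥ (λ _ → 0ℤ)) b  ≡⟨ *ᵥ-zero T⁻¹ b ⟩
      0ℤ                     ∎)
    nonzero = Fin.¬∀⟶∃¬ k (λ a → w a ≡ 0ℤ) (λ a → w a ℤ.≟ 0ℤ) w≢0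

  entails⇒gcd∣ : ∀ {q c} → 0 < q → Entails q M c → ∀ p → gcd q (d (toℕ p)) ℕ.∣ ∣ (S *ᵥ c) p ∣
  entails⇒gcd∣ {q} {c} 0<q entails p = ∣*⇒gcd∣ 0<q λ h q∣hd →
    subst (q ℕ.∣_) (∣h·Sp∣ h c) (entails (+ h · S p) λ a →
      subst (q ℕ.∣_) (sym (∣h·Sp∣ h (col M a))) (ℕ.∣-trans q∣hd (ℕ.*-monoʳ-∣ h (∣⇒∣ᵤ (∈L⇒d∣ (col∈L M a) p)))))
    where
    ∣h·Sp∣ : ∀ h v → ∣ dot (+ h · S p) v ∣ ≡ h ℕ.* ∣ (S *ᵥ v) p ∣
    ∣h·Sp∣ h v = trans (cong ∣_∣ (dot-scaleˡ (+ h) (S p) v)) (ℤ.abs-* (+ h) _)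

  gcd∣⇒entails : ∀ {q c} → (∀ p → gcd q (d (toℕ p)) ℕ.∣ ∣ (S *ᵥ c) p ∣) → Entails q M c
  gcd∣⇒entails {q} {c} gcd∣ x q∣xM = ∣⇒∣ᵤ (subst (+ q ∣_) (sym xc≡ySc) (∣-sum q∣yS))
    where
    y = x ᵥ* S⁻¹
    xc≡ySc : dot x c ≡ dot y (S *ᵥ c)
    xc≡ySc = trans (dot-congʳ x (λ i → sym (S⁻¹*ᵥS c i))) (dot-*ᵥ x S⁻¹ (S *ᵥ c))
    q∣yd : ∀ p → q ℕ.∣ ∣ y p ∣ ℕ.* d (toℕ p)
    q∣yd p = subst (q ℕ.∣_) (trans (cong ∣_∣ (dot-scaleʳ (+ d (toℕ p)) x (col S⁻¹ p)))
                                   (trans (ℤ.abs-* (+ d (toℕ p)) (y p)) (ℕ.*-comm (d (toℕ p)) ∣ y p ∣)))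
                   (∣⇒∣ᵤ (∣-dot-∈L x M (λ a → ∣ᵤ⇒∣ {+ q} (q∣xM a)) (d·colS⁻¹∈L p)))
    q∣yS : ∀ p → + q ∣ y p * (S *ᵥ c) p
    q∣yS p = ∣ᵤ⇒∣ (subst (q ℕ.∣_) (sym (ℤ.abs-* (y p) _)) (gcd∣⇒∣* ∣ y p ∣ (gcd∣ p) (q∣yd p)))

admissible⇒SmithForm : ∀ {m k} {M : Mat m k} {S} → AdmissibleS M S → SmithForm M
admissible⇒SmithForm {S = S} ((S⁻¹ , S⊗S⁻¹ , S⁻¹⊗S) , T , (T⁻¹ , T⊗T⁻¹ , T⁻¹⊗T) , rank , e , isSNF) =
  mkSmithForm S S⁻¹ T T⁻¹ S⊗S⁻¹ S⁻¹⊗S T⊗T⁻¹ T⁻¹⊗T rank e isSNF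

largestElemDiv : ∀ {m k} {M : Mat m k} (F : SmithForm M) {l} → SmithForm.rank F ≡ suc l →
                 IsLargestElemDiv M (SmithForm.d F l)
largestElemDiv (mkSmithForm S S⁻¹ T T⁻¹ S⊗S⁻¹ S⁻¹⊗S T⊗T⁻¹ T⁻¹⊗T _ e isSNF) {l} refl =
  S , T , (S⁻¹ , S⊗S⁻¹ , S⁻¹⊗S) , (T⁻¹ , T⊗T⁻¹ , T⁻¹⊗T) , l , e , isSNF ,
  trans (pad-< e (ℕ.n<1+n l)) (cong e (sym (Fin.fromℕ-def l)))

-- With u = S⁻¹ e_p, the vector d_p u lies in L(M), so a nonzero multiple of u lies in L(M′);
-- L(M′) is saturated up to its largest elementary divisor E, so E u lies in L(M′) ⊆ L(M),
-- and reading off coordinate p in S-coordinates gives d_p ∣ E.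
elemDiv∣largestElemDiv : ∀ {m k k′} {M : Mat m k} {M′ : Mat m k′} (F : SmithForm M) (F′ : SmithForm M′) →
  M′ ⊆ᴸ M → M ⊆ℚᴸ M′ → ∀ p → toℕ p < SmithForm.rank F →
  ∃ λ l → SmithForm.rank F′ ≡ suc l × SmithForm.d F (toℕ p) ℕ.∣ SmithForm.d F′ l
elemDiv∣largestElemDiv {M′ = M′} F F′ M′⊆M M⊆M′ p p<rank = by-rank F′.rank refl
  where
  open ≡-Reasoning
  module F  = SmithForm F
  module F′ = SmithForm F′
  u = col F.S⁻¹ p
  multiple : ∃ λ N → N ≢ 0ℤ × N · + F.d (toℕ p) · u ∈L M′
  multiple = M⊆M′ (F.d·colS⁻¹∈L p)
  N′ = proj₁ multiple * + F.d (toℕ p)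
  N′≢0 : N′ ≢ 0ℤ
  N′≢0 = *-≢0 (proj₁ (proj₂ multiple)) (λ dₚ≡0 → ℕ.<⇒≢ (F.d-pos p<rank) (sym (cong ∣_∣ dₚ≡0)))
  N′u∈L : N′ · u ∈L M′
  N′u∈L = ∈L-resp-≗ M′ (λ i → sym (ℤ.*-assoc (proj₁ multiple) _ (u i))) (proj₂ (proj₂ multiple))
  by-rank : ∀ r → F′.rank ≡ r → ∃ λ l → F′.rank ≡ suc l × F.d (toℕ p) ℕ.∣ F′.d l
  by-rank zero    rank≡0 = ⊥-elim (N′≢0 (begin
    N′                     ≡⟨ F.S*ᵥ·colS⁻¹-diag N′ p ⟨
    (F.S *ᵥ N′ · u) p      ≡⟨ *ᵥ-congʳ F.S (F′.rank≡0⇒∈L-trivial rank≡0 N′u∈L) p ⟩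
    (F.S *ᵥ (λ _ → 0ℤ)) p  ≡⟨ *ᵥ-zero F.S p ⟩
    0ℤ                     ∎))
  by-rank (suc l) rank≡ = l , rank≡ , ∣⇒∣ᵤ (subst (+ F.d (toℕ p) ∣_) (F.S*ᵥ·colS⁻¹-diag (+ F′.d l) p)
                                                (F.∈L⇒d∣ (M′⊆M (F′.saturate rank≡ N′≢0 N′u∈L)) p))

strictlyIncreasing-injective : ∀ {k n} {σ : Fin k → Fin n} → StrictlyIncreasing σ → Injective _≡_ _≡_ σ
strictlyIncreasing-injective σ↑ {a} {b} σa≡σb with Fin.<-cmp a b
... | tri< a<b _ _ = ⊥-elim (Fin.<⇒≢ (σ↑ a b a<b) σa≡σb)
... | tri≈ _ a≡b _ = a≡b
... | tri> _ _ b<a = ⊥-elim (Fin.<⇒≢ (σ↑ b a b<a) (sym σa≡σb))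

∘punchIn-strictlyIncreasing : ∀ {k n} {σ : Fin (suc k) → Fin n} → StrictlyIncreasing σ → ∀ a →
                              StrictlyIncreasing (σ ∘ punchIn a)
∘punchIn-strictlyIncreasing σ↑ a i j i<j = σ↑ _ _
  (Fin.≤∧≢⇒< (Fin.punchIn-mono-≤ a i j (ℕ.<⇒≤ i<j)) (λ eq → Fin.<⇒≢ i<j (Fin.punchIn-injective a i j eq)))

record SpanningSubfamily {m n k} (C : Mat m n) (σ : Fin (suc k) → Fin n) : Set where
  field
    {k′}    : ℕ
    σ′      : Fin (suc k′) → Fin n
    σ′↑     : StrictlyIncreasing σ′
    small   : suc k′ ≤ m
    sub     : cols C σ′ ⊆ᴸ cols C σ
    ratSpan : cols C σ ⊆ℚᴸ cols C σ′

module _ {m n} (C : Mat m n)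
         (smith : ∀ {k} (σ : Fin (suc k) → Fin n) → StrictlyIncreasing σ → SmithForm (cols C σ)) where

  -- While there are more columns than rows, a kernel vector lets one column be dropped.
  spanningSubfamily : ∀ {k} (σ : Fin (suc k) → Fin n) → StrictlyIncreasing σ → 0 < m → SpanningSubfamily C σ
  spanningSubfamily {k} σ σ↑ 0<m = [ keep , drop k σ σ↑ ]′ (ℕ.≤-<-connex (suc k) m)
    where
    keep : suc k ≤ m → SpanningSubfamily C σ
    keep small = record { σ′ = σ ; σ′↑ = σ↑ ; small = small ; sub = λ v∈L → v∈L ; ratSpan = ⊆ℚᴸ-refl (cols C σ) }
    drop : ∀ k (σ : Fin (suc k) → Fin n) → StrictlyIncreasing σ → m < suc k → SpanningSubfamily C σ
    drop zero    σ σ↑ m<1 = ⊥-elim (ℕ.<⇒≱ m<1 0<m)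
    drop (suc k) σ σ↑ m<k = dropColumn (SmithForm.wide⇒kernel (smith σ σ↑) m<k)
      where
      dropColumn : (∃ λ w → ∃ λ a → w a ≢ 0ℤ × cols C σ *ᵥ w ≗ (λ _ → 0ℤ)) → SpanningSubfamily C σ
      dropColumn (w , a , wa≢0 , Cw≗0) = record
        { σ′      = Sub.σ′
        ; σ′↑     = Sub.σ′↑
        ; small   = Sub.small
        ; sub     = λ v∈L → removeCol-⊆ᴸ (cols C σ) a (Sub.sub v∈L)
        ; ratSpan = ⊆ℚᴸ-trans (cols C σ) (removeCol (cols C σ) a) (cols C Sub.σ′)
                      (kernel⇒⊆ℚᴸ-removeCol (cols C σ) {w} Cw≗0 wa≢0) Sub.ratSpan
        }
        where module Sub = SpanningSubfamily (spanningSubfamily (σ ∘ punchIn a) (∘punchIn-strictlyIncreasing σ↑ a) 0<m)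

  elemDiv∣ρ0 : ∀ {ρ0} → (∀ e → IsSmallE C e → e ℕ.∣ ρ0) →
               ∀ {k} {σ : Fin (suc k) → Fin n} → StrictlyIncreasing σ → (F : SmithForm (cols C σ)) →
               ∀ p → toℕ p < SmithForm.rank F → SmithForm.d F (toℕ p) ℕ.∣ ρ0
  elemDiv∣ρ0 {ρ0} small∣ρ0 σ↑ F p p<rank = conclude (elemDiv∣largestElemDiv F F′ Sub.sub Sub.ratSpan p p<rank)
    where
    module Sub = SpanningSubfamily (spanningSubfamily _ σ↑ (ℕ.≤-<-trans z≤n (Fin.toℕ<n p)))
    F′ = smith Sub.σ′ Sub.σ′↑
    conclude : (∃ λ l → SmithForm.rank F′ ≡ suc l × SmithForm.d F (toℕ p) ℕ.∣ SmithForm.d F′ l) →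
               SmithForm.d F (toℕ p) ℕ.∣ ρ0
    conclude (l , rank≡ , dₚ∣E) = ℕ.∣-trans dₚ∣E (small∣ρ0 _
      (_ , Sub.σ′ , Sub.σ′↑ , Sub.small , Fin.injective⇒≤ (strictlyIncreasing-injective Sub.σ′↑) ,
       largestElemDiv F′ rank≡))

foldr-⊔-≥ : ∀ {n} (f : Vector ℕ n) i → f i ≤ foldr _⊔_ 0 f
foldr-⊔-≥ f Fin.zero    = ℕ.m≤m⊔n _ _
foldr-⊔-≥ f (Fin.suc i) = ℕ.≤-trans (foldr-⊔-≥ (f ∘ Fin.suc) i) (ℕ.m≤n⊔m _ _)

∣entry∣≤maxAbs : ∀ {m k} (A : Mat m k) i j → ∣ A i j ∣ ≤ maxAbs A
∣entry∣≤maxAbs A i j =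
  ℕ.≤-trans (foldr-⊔-≥ (λ j → ∣ A i j ∣) j) (foldr-⊔-≥ (λ i → foldr _⊔_ 0 (λ j → ∣ A i j ∣)) i)

minimalSmithForm : ∀ {m n q0} {C : Mat m n} → IsQ0 C q0 → ∀ {k} (σ : Fin (suc k) → Fin n) → StrictlyIncreasing σ →
                   Σ (SmithForm (cols C σ)) λ F → cost C (SmithForm.S F) ≤ q0
minimalSmithForm (bounded , _) σ σ↑ =
  let (_ , ((_ , admissible , cost≡) , _) , ≤q0) = bounded _ σ σ↑
  in  admissible⇒SmithForm admissible , subst (_≤ _) (sym cost≡) ≤q0

theorem3p1 : ∀ {m n} (C : Mat m n) → NonzeroColumns C →
    (ρ0 q0 : ℕ) → IsRho0 C ρ0 → IsQ0 C q0 →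
    ∀ k (σ : Fin (suc k) → Fin n) → StrictlyIncreasing σ →
    (q q' : ℕ) → 0 < q → 0 < q' → q0 < q → q0 < q' → gcd ρ0 q ≡ gcd ρ0 q' →
    (j : Fin n) → HContains C q j σ ⇔ HContains C q' j σ
theorem3p1 C _ ρ0 q0 isρ0 isq0 k σ σ↑ q q′ 0<q 0<q′ q0<q q0<q′ gcd≡ j =
  mk⇔ (transfer 0<q q0<q gcd≡) (transfer 0<q′ q0<q′ (sym gcd≡))
  where
  smith : ∀ {k} (σ : Fin (suc k) → Fin _) → StrictlyIncreasing σ → SmithForm (cols C σ)
  smith σ σ↑ = proj₁ (minimalSmithForm isq0 σ σ↑)
  open SmithForm (smith σ σ↑)
  ∣s∣≤q0 : ∀ p → ∣ (S *ᵥ col C j) p ∣ ≤ q0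
  ∣s∣≤q0 p = ℕ.≤-trans (∣entry∣≤maxAbs (S ⊗ C) p j)
                       (ℕ.≤-trans (ℕ.m≤m⊔n _ _) (proj₂ (minimalSmithForm isq0 σ σ↑)))
  d∣ρ0⊎d≡0 : ∀ p → d (toℕ p) ℕ.∣ ρ0 ⊎ d (toℕ p) ≡ 0
  d∣ρ0⊎d≡0 p = Sum.map (elemDiv∣ρ0 C smith (proj₁ isρ0) σ↑ (smith σ σ↑) p) d-≥ (ℕ.<-≤-connex (toℕ p) rank)
  transfer : ∀ {q q′} → 0 < q → q0 < q → gcd ρ0 q ≡ gcd ρ0 q′ → HContains C q j σ → HContains C q′ j σ
  transfer 0<q q0<q gcd≡ H = gcd∣⇒entails λ p →
    gcd∣-transfer (d∣ρ0⊎d≡0 p) gcd≡ (ℕ.≤-<-trans (∣s∣≤q0 p) q0<q) (entails⇒gcd∣ 0<q H p)
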